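{- Consider the generalized Sudoku problem with data $n, \pi_1, \pi_2, \pi_3, i_1, \ldots, i_k, g_{i_1}, \ldots, g_{i_k}$ and solution set $S(n,g)$, and let $x \in S(n, g)$. Then $S(n, g)$ equals the set of all $y \in \mathbb{Z}^{n^2}$ for which there exist permutations $\tau_1, \tau_2, \tau_3$ of $\{1, \ldots, n^2\}$ such that $y = \tau_r(x)$ for $r = 1, 2, 3$, $\tau_r$ is $\pi_r$-consistent for $r = 1, 2, 3$, and $\tau_r(i_l) = i_l$ for $l = 1, \ldots, k$ and $r = 1, 2, 3$.
   Context: For $y \in \mathbb{Z}^s$ write $y <> \mathbf{0}$ if every component of $y$ is nonzero. Let $n \ge 2$ and $s(n) = \sum_{i=1}^{n-1} i$. The $s(n) \times n$ matrix $A(n)$ is defined inductively: $A(1)$ is the empty matrix, and $A(m) = \begin{pmatrix} \mathbf{1}_{m-1} & -U_{m-1} \\ \mathbf{0}_{s(m-1)} & A(m-1) \end{pmatrix}$, where $\mathbf{1}_{m-1}$ is the all-ones column, $U_{m-1}$ the identity matrix and $\mathbf{0}_{s(m-1)}$ the zero column of length $s(m-1)$. Let $A$ be the $(n \cdot s(n)) \times n^2$ block-diagonal matrix whose $n$ diagonal blocks all equal $A(n)$. For a permutation $\pi$ of $\{1,\ldots,n^2\}$, $A_\pi$ is the matrix whose $j$-th column is the $\pi^{ -1}(j)$-th column of $A$. For a permutation $\tau$ and $x \in \mathbb{Z}^{n^2}$, $\tau(x) = (x_{\tau^{ -1}(1)}, \ldots, x_{\tau^{ -1}(n^2)})^T$.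 The constraint sets of $\pi$ are $cs_\pi(j) = \{\pi(i) \mid (j-1)n + 1 \le i \le jn\}$, $j=1,\ldots,n$. A permutation $\tau$ is $\pi$-consistent if $\tau(cs_\pi(j)) = cs_\pi(j)$ for $j = 1,\ldots,n$. Generalized Sudoku problem: given permutations $\pi_1, \pi_2, \pi_3$ of $\{1, \ldots, n^2\}$, an integer $0 \le k \le n^2$, an index set $\{i_1, \ldots, i_k\} \subset \{1, \ldots, n^2\}$ and givens $g_{i_l} \in \mathbb{Z}$ with $1 \le g_{i_l} \le n$, its solution set is $S(n,g) = \{x \in \mathbb{Z}^{n^2} \mid 1 \le x_i \le n \ (i = 1,\ldots,n^2),\ A_{\pi_r}x <> \mathbf{0}\ (r = 1,2,3),\ x_{i_l} = g_{i_l}\ (l = 1, \ldots, k)\}$. -}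

module Defs where

open import Data.Nat as N using (ℕ; zero; suc)
open import Data.Integer as ℤ using (ℤ; +_; -_; _*_; _+_; _≤_)
open import Data.Fin as Fin using (Fin; zero; suc; splitAt; remQuot)
open import Data.Fin.Permutation using (Permutation′; _⟨$⟩ʳ_; _⟨$⟩ˡ_)
open import Data.Sum using (inj₁; inj₂)
open import Data.Product using (_×_; ∃; ∃-syntax; proj₁; _,_)
open import Data.Bool using (if_then_else_)
open import Relation.Nullary using (¬_)
open import Relation.Nullary.Decidable using (⌊_⌋)
open import Relation.Binary.PropositionalEquality using (_≡_)

Matrix : ℕ → ℕ → Set
Matrix r c = Fin r → Fin c → ℤ

Vect : ℕ → Set
Vect m = Fin m → ℤ

sumFin : ∀ {m} → (Fin m → ℤ) → ℤ
sumFin {zero}  f = + 0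
sumFin {suc m} f = f zero + sumFin (λ i → f (suc i))

_·_ : ∀ {r c} → Matrix r c → Vect c → Vect r
(M · x) i = sumFin (λ j → M i j * x j)

AllNonzero : ∀ {m} → Vect m → Set
AllNonzero y = ∀ i → ¬ (y i ≡ + 0)

-- s(m) = Σ_{i=1}^{m-1} i, given by s(m+1) = m + s(m), s(0) = s(1) = 0
s : ℕ → ℕ
s zero    = zero
s (suc m) = m N.+ s m

-- A(m), the s(m) × m matrix; first m-1 rows (block (1 | -U)), then (0 | A(m-1)).
Amat : ∀ m → Matrix (s m) m
Amat zero ()
Amat (suc m) r c with splitAt m r
Amat (suc m) r zero    | inj₁ i = + 1
Amat (suc m) r (suc j) | inj₁ i = if ⌊ i Fin.≟ j ⌋ then - (+ 1) else + 0
Amat (suc m) r zero    | inj₂ q = + 0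
Amat (suc m) r (suc j) | inj₂ q = Amat m q j

-- The (n·s(n)) × n² block-diagonal matrix with n diagonal blocks A(n).
Ablock : ∀ n → Matrix (n N.* s n) (n N.* n)
Ablock n r c with remQuot {n} (s n) r | remQuot {n} n c
... | b , i | b′ , j = if ⌊ b Fin.≟ b′ ⌋ then Amat n i j else + 0


Aπ : ∀ n → Permutation′ (n N.* n) → Matrix (n N.* s n) (n N.* n)
Aπ n π r j = Ablock n r (π ⟨$⟩ˡ j)

permVec : ∀ {m} → Permutation′ m → Vect m → Vect m
permVec τ x i = x (τ ⟨$⟩ˡ i)

-- k ∈ cs_π(j) = {π(i) | (j-1)n+1 ≤ i ≤ jn}  (0-indexed: i in block j)
_∈cs[_,_] : ∀ {n} → Fin (n N.* n) → Permutation′ (n N.* n) → Fin n → Set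
_∈cs[_,_] {n} k π j = ∃[ i ] (proj₁ (remQuot {n} n i) ≡ j × π ⟨$⟩ʳ i ≡ k)

_∈τcs[_,_,_] : ∀ {n} → Fin (n N.* n) → Permutation′ (n N.* n) → Permutation′ (n N.* n) → Fin n → Set
k ∈τcs[ τ , π , j ] = ∃[ m ] (m ∈cs[ π , j ] × τ ⟨$⟩ʳ m ≡ k)

Consistent : ∀ n → Permutation′ (n N.* n) → Permutation′ (n N.* n) → Set
Consistent n π τ = ∀ (j : Fin n) (k : Fin (n N.* n)) →
  (k ∈τcs[ τ , π , j ] → k ∈cs[ π , j ]) × (k ∈cs[ π , j ] → k ∈τcs[ τ , π , j ])

-- Membership in the solution set S(n,g); the three permutations are π 0, π 1, π 2,
-- the k givens are at positions idx l with values g l.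
InS : ∀ n (π : Fin 3 → Permutation′ (n N.* n)) (k : ℕ)
      (idx : Fin k → Fin (n N.* n)) (g : Fin k → ℤ) → Vect (n N.* n) → Set
InS n π k idx g x =
  (∀ i → (+ 1 ≤ x i) × (x i ≤ + n)) ×
  (∀ r → AllNonzero (Aπ n (π r) · x)) ×
  (∀ l → x (idx l) ≡ g l)

module Submission where

-- Write the n² cells as pairs (b , c) via Fin.combine, and for a
-- permutation P of the cells call c ↦ v (P (b , c)) the b-th block of v along P;
-- these blocks are exactly the constraint sets cs_P(b).
--
--  * A(m)·z has no zero entry iff z is injective: the first m-1 rows of A(m)
--    compute z₁ - zᵢ, the remaining ones are A(m-1) applied to the tail of z.
--  * Row (b , i) of A_P·v is row i of A(n) applied to the b-th block of v along
--    P, so A_P·v <> 0 iff every block of v along P is injective.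
--  * (⊆) If x and y are solutions, in each block both are injective maps into
--    {1,…,n}, so a permutation σ_b of the block carries one to the other.
--    Doing this in every block and conjugating by P gives a P-consistent τ
--    with y = τ(x); σ_b fixes every cell where x and y agree, so every given.
--  * (⊇) A P-consistent τ maps every block into itself, so each block of τ(x)
--    is a reindexing of the corresponding block of x and stays injective;
--    range and givens carry over because y = τ(x) and τ fixes the givens.

open import Defs
open import Data.Nat as N using (ℕ; zero; suc; s≤s; _≥_; NonZero)
import Data.Nat.Properties as NP
open import Data.Nat.DivMod using (_mod_; m<n⇒m%n≡m)
open import Data.Integer as ℤ using (ℤ; +_; -_; _*_; _+_; _-_; _≤_)
import Data.Integer.Properties as ℤP
open import Data.Fin as Fin
  using (Fin; zero; suc; splitAt; combine; quotient; remainder; _↑ˡ_; _↑ʳ_; toℕ; punchOut)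
import Data.Fin.Properties as FinP
open import Data.Fin.Permutation
  using (Permutation′; permutation; _⟨$⟩ʳ_; _⟨$⟩ˡ_; inverseˡ; inverseʳ; flip; _∘ₚ_)
open import Data.Sum using (_⊎_; inj₁; inj₂)
open import Data.Product using (_×_; ∃; Σ-syntax; proj₁; proj₂; _,_)
open import Data.Bool using (if_then_else_)
open import Function using (_∘_)
open import Function.Definitions using (Injective)
open import Relation.Nullary using (¬_; Dec; yes; no; contradiction)
open import Relation.Nullary.Decidable using (⌊_⌋)
open import Relation.Binary.PropositionalEquality
import Algebra.Properties.CommutativeMonoid.Sum as CMSum
open CMSum ℤP.+-0-commutativeMonoid using (sum; sum-permute)

sumFin-cong : ∀ {m} {f g : Fin m → ℤ} → (∀ j → f j ≡ g j) → sumFin f ≡ sumFin g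
sumFin-cong {zero}  f≗g = refl
sumFin-cong {suc m} f≗g = cong₂ _+_ (f≗g zero) (sumFin-cong (f≗g ∘ suc))

sumFin-zero : ∀ {m} {f : Fin m → ℤ} → (∀ j → f j ≡ + 0) → sumFin f ≡ + 0
sumFin-zero {zero}  f≗0 = refl
sumFin-zero {suc m} f≗0 = cong₂ _+_ (f≗0 zero) (sumFin-zero (f≗0 ∘ suc))

sumFin≡sum : ∀ {m} (f : Fin m → ℤ) → sumFin f ≡ sum f
sumFin≡sum {zero}  f = refl
sumFin≡sum {suc m} f = cong (_+_ (f zero)) (sumFin≡sum (f ∘ suc))

sumFin-permute : ∀ {m} (P : Permutation′ m) (f : Fin m → ℤ) →
                 sumFin f ≡ sumFin (λ c → f (P ⟨$⟩ʳ c))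
sumFin-permute P f = begin
  sumFin f                     ≡⟨ sumFin≡sum f ⟩
  sum f                        ≡⟨ sum-permute f P ⟩
  sum (λ c → f (P ⟨$⟩ʳ c))     ≡⟨ sumFin≡sum (λ c → f (P ⟨$⟩ʳ c)) ⟨
  sumFin (λ c → f (P ⟨$⟩ʳ c))  ∎
  where open ≡-Reasoning

sumFin-++ : ∀ p q (f : Fin (p N.+ q) → ℤ) →
            sumFin f ≡ sumFin (λ i → f (i ↑ˡ q)) + sumFin (λ i → f (p ↑ʳ i))
sumFin-++ zero    q f = sym (ℤP.+-identityˡ _)
sumFin-++ (suc p) q f = trans (cong (_+_ (f zero)) (sumFin-++ p q (f ∘ suc)))
                              (sym (ℤP.+-assoc (f zero) _ _))

sumFin-combine : ∀ a k (f : Fin (a N.* k) → ℤ) →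
                 sumFin f ≡ sumFin (λ b → sumFin (λ c → f (combine {a} {k} b c)))
sumFin-combine zero    k f = refl
sumFin-combine (suc a) k f = trans (sumFin-++ k (a N.* k) f)
  (cong (_+_ (sumFin (λ c → f (c ↑ˡ (a N.* k))))) (sumFin-combine a k (λ i → f (k ↑ʳ i))))

sumFin-single : ∀ {a} (f : Fin a → ℤ) (B : Fin a) → (∀ b → B ≢ b → f b ≡ + 0) →
                sumFin f ≡ f B
sumFin-single {suc a} f zero    off = trans (cong (_+_ (f zero)) (sumFin-zero (λ j → off (suc j) λ ())))
                                            (ℤP.+-identityʳ _)
sumFin-single {suc a} f (suc B) off = trans (cong (_+ sumFin (f ∘ suc)) (off zero λ ()))
  (trans (ℤP.+-identityˡ _)
         (sumFin-single (f ∘ suc) B (λ b B≢b → off (suc b) (B≢b ∘ FinP.suc-injective))))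

negDelta : ∀ {m} → Fin m → Fin m → ℤ
negDelta i j = if ⌊ i Fin.≟ j ⌋ then - (+ 1) else + 0

negDelta-sum : ∀ {m} (i : Fin m) (f : Fin m → ℤ) → sumFin (λ j → negDelta i j * f j) ≡ - f i
negDelta-sum {suc m} zero f = begin
  - (+ 1) * f zero + sumFin (λ j → negDelta zero (suc j) * f (suc j))
    ≡⟨ cong (_+_ (- (+ 1) * f zero)) (sumFin-zero {m} (λ _ → refl)) ⟩
  - (+ 1) * f zero + + 0   ≡⟨ ℤP.+-identityʳ _ ⟩
  - (+ 1) * f zero         ≡⟨ ℤP.-1*i≡-i (f zero) ⟩
  - f zero                 ∎
  where open ≡-Reasoning
negDelta-sum {suc m} (suc i) f =
  trans (ℤP.+-identityˡ _) (trans (sumFin-cong shift) (negDelta-sum i (f ∘ suc)))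
  where
  shift : ∀ j → negDelta (suc i) (suc j) * f (suc j) ≡ negDelta i j * f (suc j)
  shift j with i Fin.≟ j
  ... | yes _ = refl
  ... | no  _ = refl

rowOf : ∀ m → Vect (suc m) → Fin m ⊎ Fin (s m) → ℤ
rowOf m z (inj₁ i) = z zero - z (suc i)
rowOf m z (inj₂ q) = (Amat m · (z ∘ suc)) q

Amat-row : ∀ m (z : Vect (suc m)) r → (Amat (suc m) · z) r ≡ rowOf m z (splitAt m r)
Amat-row m z r with splitAt m r
... | inj₁ i = cong₂ _+_ (ℤP.*-identityˡ (z zero)) (negDelta-sum i (z ∘ suc))
... | inj₂ q = ℤP.+-identityˡ _

Amat-top : ∀ m (z : Vect (suc m)) i → (Amat (suc m) · z) (i ↑ˡ s m) ≡ z zero - z (suc i)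
Amat-top m z i = trans (Amat-row m z _) (cong (rowOf m z) (FinP.splitAt-↑ˡ m i (s m)))

Amat-bottom : ∀ m (z : Vect (suc m)) q → (Amat (suc m) · z) (m ↑ʳ q) ≡ (Amat m · (z ∘ suc)) q
Amat-bottom m z q = trans (Amat-row m z _) (cong (rowOf m z) (FinP.splitAt-↑ʳ m (s m) q))

Amat-nonzero⇒injective : ∀ m (z : Vect m) → AllNonzero (Amat m · z) → Injective _≡_ _≡_ z
Amat-nonzero⇒injective (suc m) z nz {zero}  {zero}  _ = refl
Amat-nonzero⇒injective (suc m) z nz {zero}  {suc j} e =
  contradiction (trans (Amat-top m z j) (ℤP.i≡j⇒i-j≡0 e)) (nz (j ↑ˡ s m))
Amat-nonzero⇒injective (suc m) z nz {suc i} {zero}  e =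
  contradiction (trans (Amat-top m z i) (ℤP.i≡j⇒i-j≡0 (sym e))) (nz (i ↑ˡ s m))
Amat-nonzero⇒injective (suc m) z nz {suc i} {suc j} e = cong suc
  (Amat-nonzero⇒injective m (z ∘ suc) (λ q → nz (m ↑ʳ q) ∘ trans (Amat-bottom m z q)) e)

injective⇒Amat-nonzero : ∀ m (z : Vect m) → Injective _≡_ _≡_ z → AllNonzero (Amat m · z)
injective⇒Amat-nonzero (suc m) z inj r row≡0 =
  rowOf-nonzero (splitAt m r) (trans (sym (Amat-row m z r)) row≡0)
  where
  rowOf-nonzero : ∀ w → rowOf m z w ≢ + 0
  rowOf-nonzero (inj₁ i) e = FinP.0≢1+n (inj (ℤP.i-j≡0⇒i≡j _ _ e))
  rowOf-nonzero (inj₂ q) = injective⇒Amat-nonzero m (z ∘ suc) (FinP.suc-injective ∘ inj) q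

InRange : ℕ → ℤ → Set
InRange n v = (+ 1 ≤ v) × (v ≤ + n)

-- {1,…,n} is coded by Fin n via v ↦ v - 1; the code determines values in range.
code : ∀ n .{{_ : NonZero n}} → ℤ → Fin n
code n v = (ℤ.∣ v ∣ N.∸ 1) mod n

code-decodes : ∀ n .{{_ : NonZero n}} {v} → InRange n v → v ≡ + suc (toℕ (code n v))
code-decodes n {+ zero}    (ℤ.+≤+ () , _)
code-decodes n {+ suc a}   (_ , ℤ.+≤+ a<n) =
  cong (+_ ∘ suc) (sym (trans (FinP.toℕ-fromℕ< _) (m<n⇒m%n≡m a<n)))
code-decodes n { ℤ.-[1+ _ ]} (() , _)

code-injective : ∀ n .{{_ : NonZero n}} {v w} → InRange n v → InRange n w →
                 code n v ≡ code n w → v ≡ w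
code-injective n v∈ w∈ e =
  trans (code-decodes n v∈) (trans (cong (+_ ∘ suc ∘ toℕ) e) (sym (code-decodes n w∈)))

-- Pigeonhole: an injective endomap of Fin n is onto, since missing a value t
-- would give an injection Fin n → Fin (n - 1) by punching t out.
injective⇒surjective : ∀ {n} (f : Fin n → Fin n) → Injective _≡_ _≡_ f → ∀ t → ∃ λ c → f c ≡ t
injective⇒surjective f inj t with FinP.any? (λ c → f c FinP.≟ t)
... | yes hit = hit
injective⇒surjective {zero}  f inj () | no _
injective⇒surjective {suc m} f inj t  | no miss =
  contradiction (FinP.injective⇒≤ punchOut∘f-injective) NP.1+n≰n
  where
  t≢f : ∀ c → t ≢ f c
  t≢f c t≡fc = miss (c , sym t≡fc)
  punchOut∘f-injective : Injective _≡_ _≡_ (λ c → punchOut (t≢f c))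
  punchOut∘f-injective e = inj (FinP.punchOut-injective (t≢f _) (t≢f _) e)

injection⇒permutation : ∀ {n} (f : Fin n → Fin n) → Injective _≡_ _≡_ f → Permutation′ n
injection⇒permutation f inj =
  permutation f (proj₁ ∘ onto) (proj₂ ∘ onto) (λ c → inj (proj₂ (onto (f c))))
  where
  onto : ∀ t → ∃ λ c → f c ≡ t
  onto = injective⇒surjective f inj

matching : ∀ n .{{_ : NonZero n}} (u w : Fin n → ℤ) →
           (∀ c → InRange n (u c)) → (∀ c → InRange n (w c)) →
           Injective _≡_ _≡_ u → Injective _≡_ _≡_ w →
           Σ[ σ ∈ Permutation′ n ] (∀ c → w (σ ⟨$⟩ʳ c) ≡ u c)
matching n u w u∈ w∈ u-inj w-inj =
  U ∘ₚ flip W , λ c → code-injective n (w∈ _) (u∈ c) (inverseʳ W)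
  where
  U W : Permutation′ n
  U = injection⇒permutation (code n ∘ u) (u-inj ∘ code-injective n (u∈ _) (u∈ _))
  W = injection⇒permutation (code n ∘ w) (w-inj ∘ code-injective n (w∈ _) (w∈ _))

if-yes : ∀ {A : Set} {a b : ℤ} (d : Dec A) → A → (if ⌊ d ⌋ then a else b) ≡ a
if-yes (yes _)  _ = refl
if-yes (no ¬p) p = contradiction p ¬p

if-no : ∀ {A : Set} {a b : ℤ} (d : Dec A) → ¬ A → (if ⌊ d ⌋ then a else b) ≡ b
if-no (yes p) ¬p = contradiction p ¬p
if-no (no _)  _  = refl

conjugate : ∀ {m} → Permutation′ m → Permutation′ m → Permutation′ m
conjugate P Σ = flip P ∘ₚ Σ ∘ₚ P

⟨$⟩ʳ-injective : ∀ {m} (P : Permutation′ m) → Injective _≡_ _≡_ (P ⟨$⟩ʳ_)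
⟨$⟩ʳ-injective P e = trans (sym (inverseˡ P)) (trans (cong (P ⟨$⟩ˡ_) e) (inverseˡ P))

-- The rest concerns the n × n grid: a cell i : Fin (n·n) is the pair
-- (blockOf i , positionOf i), and P carries block b onto cs_P(b).
module _ (n : ℕ) where

  blockOf : Fin (n N.* n) → Fin n
  blockOf = quotient {n} n

  positionOf : Fin (n N.* n) → Fin n
  positionOf = remainder {n} n

  cell-combine : ∀ i → combine (blockOf i) (positionOf i) ≡ i
  cell-combine = FinP.combine-remQuot {n} n

  blockOf-combine : ∀ b c → blockOf (combine b c) ≡ b
  blockOf-combine b c = cong proj₁ (FinP.remQuot-combine {n} {n} b c)

  -- The b-th block of v along P: the values of v on the constraint set cs_P(b).
  block : Permutation′ (n N.* n) → Vect (n N.* n) → Fin n → Fin n → ℤ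
  block P v b c = v (P ⟨$⟩ʳ combine b c)

  BlocksInjective : Permutation′ (n N.* n) → Vect (n N.* n) → Set
  BlocksInjective P v = ∀ b → Injective _≡_ _≡_ (block P v b)

  Ablock-combine : ∀ r b c → Ablock n r (combine b c) ≡
    (if ⌊ quotient {n} (s n) r Fin.≟ b ⌋ then Amat n (remainder {n} (s n) r) c else + 0)
  Ablock-combine r b c =
    cong (λ bc → if ⌊ quotient {n} (s n) r Fin.≟ proj₁ bc ⌋
                 then Amat n (remainder {n} (s n) r) (proj₂ bc) else + 0)
         (FinP.remQuot-combine {n} {n} b c)

  Aπ-row : ∀ P v r →
           (Aπ n P · v) r ≡ (Amat n · block P v (quotient {n} (s n) r)) (remainder {n} (s n) r)
  Aπ-row P v r = begin
    sumFin (λ c → Ablock n r (P ⟨$⟩ˡ c) * v c)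
      ≡⟨ sumFin-permute P _ ⟩
    sumFin (λ c → Ablock n r (P ⟨$⟩ˡ (P ⟨$⟩ʳ c)) * v (P ⟨$⟩ʳ c))
      ≡⟨ sumFin-cong (λ c → cong (λ t → Ablock n r t * v (P ⟨$⟩ʳ c)) (inverseˡ P)) ⟩
    sumFin (λ c → Ablock n r c * v (P ⟨$⟩ʳ c))
      ≡⟨ sumFin-combine n n (λ c → Ablock n r c * v (P ⟨$⟩ʳ c)) ⟩
    sumFin (λ b → sumFin (λ c → Ablock n r (combine b c) * block P v b c))
      ≡⟨ sumFin-single _ B (λ b B≢b → sumFin-zero (λ c → cong (_* block P v b c) (off-block b c B≢b))) ⟩
    sumFin (λ c → Ablock n r (combine B c) * block P v B c)
      ≡⟨ sumFin-cong (λ c → cong (_* block P v B c) (on-block c)) ⟩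
    sumFin (λ c → Amat n I c * block P v B c)
      ∎
    where
    open ≡-Reasoning
    B : Fin n
    B = quotient {n} (s n) r
    I : Fin (s n)
    I = remainder {n} (s n) r
    off-block : ∀ b c → B ≢ b → Ablock n r (combine b c) ≡ + 0
    off-block b c B≢b = trans (Ablock-combine r b c) (if-no (B Fin.≟ b) B≢b)
    on-block : ∀ c → Ablock n r (combine B c) ≡ Amat n I c
    on-block c = trans (Ablock-combine r B c) (if-yes (B Fin.≟ B) refl)

  nonzero⇒blocksInjective : ∀ P v → AllNonzero (Aπ n P · v) → BlocksInjective P v
  nonzero⇒blocksInjective P v nz b = Amat-nonzero⇒injective n (block P v b) λ i row≡0 →
    nz (combine b i) (trans (Aπ-row P v (combine b i))
      (subst (λ bi → (Amat n · block P v (proj₁ bi)) (proj₂ bi) ≡ + 0)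
             (sym (FinP.remQuot-combine {n} {s n} b i)) row≡0))

  blocksInjective⇒nonzero : ∀ P v → BlocksInjective P v → AllNonzero (Aπ n P · v)
  blocksInjective⇒nonzero P v inj r row≡0 =
    injective⇒Amat-nonzero n _ (inj (quotient {n} (s n) r)) (remainder {n} (s n) r)
      (trans (sym (Aπ-row P v r)) row≡0)

  withinBlocks : (Fin n → Fin n → Fin n) → Fin (n N.* n) → Fin (n N.* n)
  withinBlocks F i = combine (blockOf i) (F (blockOf i) (positionOf i))

  withinBlocks-combine : ∀ F b c → withinBlocks F (combine b c) ≡ combine b (F b c)
  withinBlocks-combine F b c =
    cong (λ bc → combine (proj₁ bc) (F (proj₁ bc) (proj₂ bc))) (FinP.remQuot-combine {n} {n} b c)

  withinBlocks-inverse : ∀ F G → (∀ b c → F b (G b c) ≡ c) →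
                         ∀ i → withinBlocks F (withinBlocks G i) ≡ i
  withinBlocks-inverse F G F∘G≡id i = begin
    withinBlocks F (combine b (G b c))  ≡⟨ withinBlocks-combine F b (G b c) ⟩
    combine b (F b (G b c))             ≡⟨ cong (combine b) (F∘G≡id b c) ⟩
    combine b c                         ≡⟨ cell-combine i ⟩
    i                                   ∎
    where
    open ≡-Reasoning
    b c : Fin n
    b = blockOf i
    c = positionOf i

  blockwise : (Fin n → Permutation′ n) → Permutation′ (n N.* n)
  blockwise σ = permutation (withinBlocks (λ b → σ b ⟨$⟩ʳ_)) (withinBlocks (λ b → σ b ⟨$⟩ˡ_))
    (withinBlocks-inverse (λ b → σ b ⟨$⟩ʳ_) (λ b → σ b ⟨$⟩ˡ_) (λ b c → inverseʳ (σ b)))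
    (withinBlocks-inverse (λ b → σ b ⟨$⟩ˡ_) (λ b → σ b ⟨$⟩ʳ_) (λ b c → inverseˡ (σ b)))

  blockwise-keeps-blocks : ∀ σ i → blockOf (blockwise σ ⟨$⟩ʳ i) ≡ blockOf i
  blockwise-keeps-blocks σ i = blockOf-combine _ _

  conjugate-consistent : ∀ P Σ → (∀ i → blockOf (Σ ⟨$⟩ʳ i) ≡ blockOf i) →
                         Consistent n P (conjugate P Σ)
  conjugate-consistent P Σ keeps j k = image⊆ , ⊆image
    where
    τ : Permutation′ (n N.* n)
    τ = conjugate P Σ
    keeps⁻¹ : ∀ i → blockOf (Σ ⟨$⟩ˡ i) ≡ blockOf i
    keeps⁻¹ i = trans (sym (keeps (Σ ⟨$⟩ˡ i))) (cong blockOf (inverseʳ Σ))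
    image⊆ : k ∈τcs[ τ , P , j ] → k ∈cs[ P , j ]
    image⊆ (_ , (i , i∈j , refl) , τPi≡k) =
      Σ ⟨$⟩ʳ i , trans (keeps i) i∈j ,
      trans (cong (λ t → P ⟨$⟩ʳ (Σ ⟨$⟩ʳ t)) (sym (inverseˡ P))) τPi≡k
    ⊆image : k ∈cs[ P , j ] → k ∈τcs[ τ , P , j ]
    ⊆image (i , i∈j , Pi≡k) =
      P ⟨$⟩ʳ (Σ ⟨$⟩ˡ i) , (Σ ⟨$⟩ˡ i , trans (keeps⁻¹ i) i∈j , refl) ,
      trans (cong (λ t → P ⟨$⟩ʳ (Σ ⟨$⟩ʳ t)) (inverseˡ P)) (trans (cong (P ⟨$⟩ʳ_) (inverseʳ Σ)) Pi≡k)

  consistent-preimage : ∀ P τ → Consistent n P τ →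
                        ∀ b c → ∃ λ c′ → τ ⟨$⟩ˡ (P ⟨$⟩ʳ combine b c) ≡ P ⟨$⟩ʳ combine b c′
  consistent-preimage P τ cons b c
    with proj₂ (cons b (P ⟨$⟩ʳ combine b c)) (combine b c , blockOf-combine b c , refl)
  ... | _ , (i , i∈b , refl) , τPi≡Pbc = positionOf i , (begin
    τ ⟨$⟩ˡ (P ⟨$⟩ʳ combine b c)                     ≡⟨ cong (τ ⟨$⟩ˡ_) τPi≡Pbc ⟨
    τ ⟨$⟩ˡ (τ ⟨$⟩ʳ (P ⟨$⟩ʳ i))                      ≡⟨ inverseˡ τ ⟩
    P ⟨$⟩ʳ i                                        ≡⟨ cong (P ⟨$⟩ʳ_) (cell-combine i) ⟨
    P ⟨$⟩ʳ combine (blockOf i) (positionOf i)       ≡⟨ cong (λ t → P ⟨$⟩ʳ combine t (positionOf i)) i∈b ⟩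
    P ⟨$⟩ʳ combine b (positionOf i)                 ∎)
    where open ≡-Reasoning

  -- If y = τ(x) with τ P-consistent, each block of y along P is the same block
  -- of x reindexed injectively, so it is injective whenever that one is.
  consistent-preserves-blocksInjective : ∀ P τ x y → Consistent n P τ →
    (∀ i → y i ≡ permVec τ x i) → BlocksInjective P x → BlocksInjective P y
  consistent-preserves-blocksInjective P τ x y cons y≡τx x-inj b {c} {c′} e =
    reindex-injective (x-inj b (trans (sym (y-block c)) (trans e (y-block c′))))
    where
    reindex : Fin n → Fin n
    reindex c = proj₁ (consistent-preimage P τ cons b c)
    reindex-spec : ∀ c → τ ⟨$⟩ˡ (P ⟨$⟩ʳ combine b c) ≡ P ⟨$⟩ʳ combine b (reindex c)
    reindex-spec c = proj₂ (consistent-preimage P τ cons b c)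
    y-block : ∀ c → block P y b c ≡ block P x b (reindex c)
    y-block c = trans (y≡τx _) (cong x (reindex-spec c))
    reindex-injective : Injective _≡_ _≡_ reindex
    reindex-injective {c} {c′} e = FinP.combine-injectiveʳ b c b c′
      (⟨$⟩ʳ-injective P (⟨$⟩ʳ-injective (flip τ)
        (trans (reindex-spec c) (trans (cong (λ t → P ⟨$⟩ʳ combine b t) e) (sym (reindex-spec c′))))))

  -- Two grids with values in {1,…,n} and injective blocks along P are related
  -- by a P-consistent τ: in every block b a permutation σ_b carries the block
  -- of x onto that of y.  τ fixes every cell where x and y already agree.
  related-by-consistent : .{{_ : NonZero n}} → ∀ P x y →
    (∀ i → InRange n (x i)) → (∀ i → InRange n (y i)) →
    BlocksInjective P x → BlocksInjective P y →
    Σ[ τ ∈ Permutation′ (n N.* n) ]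
      ((∀ i → y i ≡ permVec τ x i) × Consistent n P τ × (∀ i → x i ≡ y i → τ ⟨$⟩ʳ i ≡ i))
  related-by-consistent P x y x∈ y∈ x-inj y-inj =
    τ , y≡τx , conjugate-consistent P (blockwise σ) (blockwise-keeps-blocks σ) , τ-fixes
    where
    match : ∀ b → Σ[ σ ∈ Permutation′ n ] (∀ c → block P y b (σ ⟨$⟩ʳ c) ≡ block P x b c)
    match b = matching n (block P x b) (block P y b) (λ _ → x∈ _) (λ _ → y∈ _) (x-inj b) (y-inj b)
    σ : Fin n → Permutation′ n
    σ b = proj₁ (match b)
    τ : Permutation′ (n N.* n)
    τ = conjugate P (blockwise σ)
    -- Cell i sits at position C i of block B i along P.
    B C : Fin (n N.* n) → Fin n
    B i = blockOf (P ⟨$⟩ˡ i)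
    C i = positionOf (P ⟨$⟩ˡ i)
    cell : ∀ i → P ⟨$⟩ʳ combine (B i) (C i) ≡ i
    cell i = trans (cong (P ⟨$⟩ʳ_) (cell-combine (P ⟨$⟩ˡ i))) (inverseʳ P)
    y≡τx : ∀ i → y i ≡ permVec τ x i
    y≡τx i = begin
      y i                                           ≡⟨ cong y (cell i) ⟨
      block P y (B i) (C i)                         ≡⟨ cong (block P y (B i)) (inverseʳ (σ (B i))) ⟨
      block P y (B i) (σ (B i) ⟨$⟩ʳ (σ (B i) ⟨$⟩ˡ C i)) ≡⟨ proj₂ (match (B i)) _ ⟩
      block P x (B i) (σ (B i) ⟨$⟩ˡ C i)            ∎
      where open ≡-Reasoning
    τ-fixes : ∀ i → x i ≡ y i → τ ⟨$⟩ʳ i ≡ i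
    τ-fixes i xi≡yi = trans (cong (λ t → P ⟨$⟩ʳ combine (B i) t) σ-fixes) (cell i)
      where
      σ-fixes : σ (B i) ⟨$⟩ʳ C i ≡ C i
      σ-fixes = y-inj (B i) (trans (proj₂ (match (B i)) (C i))
                               (trans (cong x (cell i)) (trans xi≡yi (cong y (sym (cell i))))))

RelatedByConsistent : ∀ n (π : Fin 3 → Permutation′ (n N.* n)) k (idx : Fin k → Fin (n N.* n))
                      (x y : Vect (n N.* n)) → Set
RelatedByConsistent n π k idx x y =
  Σ[ τ ∈ (Fin 3 → Permutation′ (n N.* n)) ] ((∀ r i → y i ≡ permVec (τ r) x i) ×
    (∀ r → Consistent n (π r) (τ r)) × (∀ r l → τ r ⟨$⟩ʳ idx l ≡ idx l))

permVec-fixed : ∀ {m} (τ : Permutation′ m) (x : Vect m) i → τ ⟨$⟩ʳ i ≡ i → permVec τ x i ≡ x i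
permVec-fixed τ x i τi≡i = cong x (trans (cong (τ ⟨$⟩ˡ_) (sym τi≡i)) (inverseˡ τ))

theorem4p1 : (n : ℕ) → n ≥ 2 →
    (π : Fin 3 → Permutation′ (n N.* n)) →
    (k : ℕ) → (idx : Fin k → Fin (n N.* n)) → Injective _≡_ _≡_ idx →
    (g : Fin k → ℤ) → (∀ l → (+ 1 ≤ g l) × (g l ≤ + n)) →
    (x : Vect (n N.* n)) → InS n π k idx g x →
    (y : Vect (n N.* n)) →
      (InS n π k idx g y →
        Σ[ τ ∈ (Fin 3 → Permutation′ (n N.* n)) ] ((∀ r i → y i ≡ permVec (τ r) x i) ×
                (∀ r → Consistent n (π r) (τ r)) ×
                (∀ r l → τ r ⟨$⟩ʳ idx l ≡ idx l)))
      ×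
      ((Σ[ τ ∈ (Fin 3 → Permutation′ (n N.* n)) ] ((∀ r i → y i ≡ permVec (τ r) x i) ×
                (∀ r → Consistent n (π r) (τ r)) ×
                (∀ r l → τ r ⟨$⟩ʳ idx l ≡ idx l))) →
        InS n π k idx g y)
theorem4p1 n@(suc _) (s≤s _) π k idx _ g _ x (x∈ , x-nz , x-givens) y =
  solution⇒related , related⇒solution
  where
  x-blocks : ∀ r → BlocksInjective n (π r) x
  x-blocks r = nonzero⇒blocksInjective n (π r) x (x-nz r)

  solution⇒related : InS n π k idx g y → RelatedByConsistent n π k idx x y
  solution⇒related (y∈ , y-nz , y-givens) =
    (λ r → proj₁ (rel r)) , (λ r → proj₁ (proj₂ (rel r))) ,
    (λ r → proj₁ (proj₂ (proj₂ (rel r)))) ,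
    (λ r l → proj₂ (proj₂ (proj₂ (rel r))) (idx l) (trans (x-givens l) (sym (y-givens l))))
    where
    rel : ∀ r → Σ[ τ ∈ Permutation′ (n N.* n) ] ((∀ i → y i ≡ permVec τ x i) ×
                  Consistent n (π r) τ × (∀ i → x i ≡ y i → τ ⟨$⟩ʳ i ≡ i))
    rel r = related-by-consistent n (π r) x y x∈ y∈ (x-blocks r)
              (nonzero⇒blocksInjective n (π r) y (y-nz r))

  related⇒solution : RelatedByConsistent n π k idx x y → InS n π k idx g y
  related⇒solution (τ , y≡τx , consistent , fixes) =
    (λ i → subst (InRange n) (sym (y≡τx zero i)) (x∈ _)) ,
    (λ r → blocksInjective⇒nonzero n (π r) y
      (consistent-preserves-blocksInjective n (π r) (τ r) x y (consistent r) (y≡τx r) (x-blocks r))) ,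
    (λ l → trans (y≡τx zero (idx l))
                 (trans (permVec-fixed (τ zero) x (idx l) (fixes zero l)) (x-givens l)))
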